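{- Let $G=(V,E)$ be a simple graph, $C\subseteq V$ such that no vertex of $V\setminus C$ is isolated, and $m\ge2$ an integer with $m\ge\gamma_{\rm gr}(G;C)$. Let $i\in\{2,\ldots,m\}$, $k\in\{1,\ldots,i\}$, $U\subseteq V$ nonempty with $p=|U|$, $N\subseteq N^p\langle U\rangle$ (possibly empty), and $W=\{w_1,\ldots,w_t\}$ a nonempty set of $t$ vertices such that (H1) $W\subseteq N^p\langle U\rangle\setminus N$, (H2) $N\langle w_{r+1}\rangle\subseteq N\langle w_r\rangle$ for $r=1,\ldots,t-1$, (H3) $N\langle v\rangle\subseteq N\langle w_t\rangle$ for all $v\in N$. Let $j_1,\ldots,j_{t+1}\in\{1,\ldots,i\}$ with $j_1=1$, $j_{t+1}=i$ and $j_r\le j_{r+1}$ for $r=1,\ldots,t$. Then every integer feasible solution $(x,y)$ of $F_1$ (equivalently every point of $P_1$) satisfies $$\sum_{u\in U}x_{ui}+\sum_{v\in N}y_{vi}+\sum_{r=1}^t\sum_{j=j_r}^{j_{r+1}}y_{w_rj}+\sum_{v\in N^p\langle U\rangle}(p-1)y_{vk}+\sum_{q=1}^{p-1}\sum_{v\in N^q\langle U\rangle}q\,y_{vk}\le p.$$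
   Context: $N\langle v\rangle=N[v]$ (closed neighborhood) if $v\in C$ and $N\langle v\rangle=N(v)$ (open neighborhood) otherwise. A sequence $(v_1,\ldots,v_k)$ of distinct vertices is legal if $N\langle v_i\rangle\setminus\bigcup_{j<i}N\langle v_j\rangle\ne\emptyset$ for $i=2,\ldots,k$, dominating if $\bigcup_jN\langle v_j\rangle=V$; $\gamma_{\rm gr}(G;C)$ is the maximum length of a legal dominating sequence. For nonempty $U\subseteq V$ and integer $r$, $N^r\langle U\rangle=\{v\in V:|N\langle v\rangle\cap U|=r\}$. The program $F_1$ has binary variables $x_{vi},y_{vi}$ ($v\in V$, $i=1,\ldots,m$), constants $x_{v0}=1$, and constraints: (a) $\sum_{v\in V}y_{vi}\le1$ for $i=1,\ldots,m$; (b) $\sum_{i=1}^my_{vi}\le1$ for $v\in V$; (c) $x_{ui}\le x_{u(i-1)}$ for $u\in V$, $i=2,\ldots,m$; (d) $x_{ui}+\sum_{v\in N\langle u\rangle}y_{vi}\le1$ for $u\in V$, $i=1,\ldots,m$; (e) $y_{vi}\le\sum_{u\in N\langle v\rangle}(x_{u(i-1)}-x_{ui})$ for $v\in V$, $i=2,\ldots,m$; all variables binary. $P_1$ is the convex hull of the integer feasible solutions of $F_1$. -}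

module Defs where

open import Data.Nat using (ℕ; zero; suc; _+_; _*_; _∸_; _≤_; _<_; _≡ᵇ_)
open import Data.Bool using (Bool; true; false; _∧_; _∨_; if_then_else_)
open import Data.Fin using (Fin; toℕ)
import Data.Fin as F
open import Data.Product using (Σ; ∃; _×_; _,_)
open import Relation.Binary.PropositionalEquality using (_≡_)
open import Function.Definitions using (Injective)

record Graph (n : ℕ) : Set where
  field
    adj    : Fin n → Fin n → Bool
    sym    : ∀ u v → adj u v ≡ adj v u
    irrefl : ∀ v → adj v v ≡ false
open Graph public

[_] : Bool → ℕ
[ b ] = if b then 1 else 0

ΣV : {n : ℕ} → (Fin n → ℕ) → ℕ
ΣV {zero}  f = 0
ΣV {suc n} f = f F.zero + ΣV (λ v → f (F.suc v))

sumN : ℕ → (ℕ → ℕ) → ℕ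
sumN zero    f = 0
sumN (suc l) f = sumN l f + f l

-- sumRange a b f = Σ_{k=a}^{b} f k   (0 if b < a)
sumRange : ℕ → ℕ → (ℕ → ℕ) → ℕ
sumRange a b f = sumN (suc b ∸ a) (λ d → f (a + d))

-- NB G C v u = true  iff  u ∈ N⟨v⟩
-- (N⟨v⟩ = N[v] if v ∈ C, N(v) otherwise)
NB : {n : ℕ} → Graph n → (Fin n → Bool) → Fin n → Fin n → Bool
NB G C v u = (C v ∧ (toℕ u ≡ᵇ toℕ v)) ∨ adj G v u

NSub : {n : ℕ} → Graph n → (Fin n → Bool) → Fin n → Fin n → Set
NSub G C v w = ∀ u → NB G C v u ≡ true → NB G C w u ≡ true

card : {n : ℕ} → (Fin n → Bool) → ℕ
card U = ΣV (λ u → [ U u ])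

-- |N⟨v⟩ ∩ U|;  v ∈ N^r⟨U⟩  iff  cnt G C U v ≡ r
cnt : {n : ℕ} → Graph n → (Fin n → Bool) → (Fin n → Bool) → Fin n → ℕ
cnt G C U v = ΣV (λ u → [ NB G C v u ∧ U u ])

-- Sequences (v_0,...,v_{k-1}) of distinct vertices, given as injective maps Fin k → Fin n
Legal : {n k : ℕ} → Graph n → (Fin n → Bool) → (Fin k → Fin n) → Set
Legal G C s = ∀ i → 1 ≤ toℕ i →
  ∃ λ u → (NB G C (s i) u ≡ true) × (∀ j → toℕ j < toℕ i → NB G C (s j) u ≡ false)

Dominating : {n k : ℕ} → Graph n → (Fin n → Bool) → (Fin k → Fin n) → Set
Dominating G C s = ∀ u → ∃ λ j → NB G C (s j) u ≡ true

GrundyAtMost : {n : ℕ} → Graph n → (Fin n → Bool) → ℕ → Set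
GrundyAtMost {n} G C m = ∀ (k : ℕ) (s : Fin k → Fin n) →
  Injective _≡_ _≡_ s → Legal G C s → Dominating G C s → k ≤ m

-- (x,y) is an integer feasible solution of F₁ (indices i = 1..m; x v 0 = 1).
-- Constraint (e) is written with the subtracted sum moved to the left side (all in ℕ).
record Feasible {n : ℕ} (G : Graph n) (C : Fin n → Bool) (m : ℕ)
                (x y : Fin n → ℕ → ℕ) : Set where
  field
    x0   : ∀ v → x v 0 ≡ 1
    xbin : ∀ v i → 1 ≤ i → i ≤ m → x v i ≤ 1
    ybin : ∀ v i → 1 ≤ i → i ≤ m → y v i ≤ 1
    ca   : ∀ i → 1 ≤ i → i ≤ m → ΣV (λ v → y v i) ≤ 1
    cb   : ∀ v → sumRange 1 m (y v) ≤ 1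
    cc   : ∀ u i → 2 ≤ i → i ≤ m → x u i ≤ x u (i ∸ 1)
    cd   : ∀ u i → 1 ≤ i → i ≤ m →
             x u i + ΣV (λ v → [ NB G C u v ] * y v i) ≤ 1
    ce   : ∀ v i → 2 ≤ i → i ≤ m →
             y v i + ΣV (λ u → [ NB G C v u ] * x u i)
               ≤ ΣV (λ u → [ NB G C v u ] * x u (i ∸ 1))

-- Read a feasible point as a legal sequence: y v l = 1 means that v is chosen at step l, and
-- x u l = 0 that u is dominated after step l. Constraint (d) makes the neighbourhood of a
-- vertex chosen at step l dominated from step l on, and (e) then forbids choosing, at a later
-- step, a vertex whose neighbourhood lies inside it. The neighbourhoods
-- N⟨w₁⟩ ⊇ … ⊇ N⟨w_t⟩ ⊇ N⟨v⟩ (v ∈ N) decrease along the windows [j_r, j_{r+1}], so at most one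
-- y-term of the chain and of N equals 1; and if one does, a vertex adjacent to all of U was
-- chosen by step i, so every x u i with u ∈ U vanishes. At step k at most one vertex z is
-- chosen; it dominates the c = |N⟨z⟩ ∩ U| vertices of U next to it, so the x-terms contribute
-- at most p − c, while the y-terms of step k contribute min c (p − 1).
module Submission where

open import Data.Bool using (Bool; true; false; _∧_; T)
open import Data.Bool.Properties using (∧-zeroʳ)
open import Data.Empty using (⊥; ⊥-elim)
open import Data.Fin using (Fin; toℕ)
import Data.Fin as F
import Data.Fin.Properties as FP
open import Data.Nat using (ℕ; zero; suc; _+_; _*_; _∸_; _≤_; _<_; _≡ᵇ_; z≤n; s≤s; _≟_)
open import Data.Nat.Properties
open import Algebra.Properties.CommutativeSemigroup +-commutativeSemigroup using (interchange)
open import Data.Product using (∃; _×_; _,_; proj₁; proj₂)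
open import Data.Sum using (_⊎_; inj₁; inj₂)
open import Data.Unit using (tt)
open import Defs hiding (sym)
open import Function using (_∘_)
open import Relation.Binary using (tri<; tri≈; tri>)
open import Relation.Binary.PropositionalEquality
  using (_≡_; _≢_; refl; sym; trans; cong; cong₂; subst; module ≡-Reasoning)
open import Relation.Nullary using (¬_; yes; no)
open import Relation.Nullary.Decidable using (dec-true; dec-false)

ΣV-mono-≤ : ∀ {n} {f g : Fin n → ℕ} → (∀ v → f v ≤ g v) → ΣV f ≤ ΣV g
ΣV-mono-≤ {zero}  f≤g = z≤n
ΣV-mono-≤ {suc n} f≤g = +-mono-≤ (f≤g F.zero) (ΣV-mono-≤ (f≤g ∘ F.suc))

ΣV-+ : ∀ {n} (f g : Fin n → ℕ) → ΣV f + ΣV g ≡ ΣV (λ v → f v + g v)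
ΣV-+ {zero}  f g = refl
ΣV-+ {suc n} f g = trans (interchange (f F.zero) (ΣV (f ∘ F.suc)) (g F.zero) (ΣV (g ∘ F.suc)))
                         (cong (f F.zero + g F.zero +_) (ΣV-+ (f ∘ F.suc) (g ∘ F.suc)))

ΣV-zero : ∀ {n} {f : Fin n → ℕ} → (∀ v → f v ≡ 0) → ΣV f ≡ 0
ΣV-zero {zero}  f≡0 = refl
ΣV-zero {suc n} f≡0 = cong₂ _+_ (f≡0 F.zero) (ΣV-zero (f≡0 ∘ F.suc))

ΣV-concentrated : ∀ {n} {f : Fin n → ℕ} z → (∀ v → v ≢ z → f v ≡ 0) → ΣV f ≡ f z
ΣV-concentrated {suc n} {f} F.zero off =
  trans (cong (f F.zero +_) (ΣV-zero (λ v → off (F.suc v) λ ()))) (+-identityʳ _)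
ΣV-concentrated {suc n} (F.suc z) off =
  cong₂ _+_ (off F.zero λ ()) (ΣV-concentrated z (λ v v≢z → off (F.suc v) (v≢z ∘ FP.suc-injective)))

term≤ΣV : ∀ {n} (f : Fin n → ℕ) v → f v ≤ ΣV f
term≤ΣV {suc n} f F.zero    = m≤m+n _ _
term≤ΣV {suc n} f (F.suc v) = ≤-trans (term≤ΣV (f ∘ F.suc) v) (m≤n+m _ _)

terms≤ΣV : ∀ {n} (f : Fin n → ℕ) {v z} → v ≢ z → f v + f z ≤ ΣV f
terms≤ΣV {suc n} f {F.zero}  {F.zero}  v≢z = ⊥-elim (v≢z refl)
terms≤ΣV {suc n} f {F.zero}  {F.suc z} _   = +-monoʳ-≤ (f F.zero) (term≤ΣV (f ∘ F.suc) z)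
terms≤ΣV {suc n} f {F.suc v} {F.zero}  _   =
  subst (_≤ ΣV f) (+-comm (f F.zero) _) (+-monoʳ-≤ (f F.zero) (term≤ΣV (f ∘ F.suc) v))
terms≤ΣV {suc n} f {F.suc v} {F.suc z} v≢z =
  ≤-trans (terms≤ΣV (f ∘ F.suc) (v≢z ∘ cong F.suc)) (m≤n+m _ _)

ΣV-positive : ∀ {n} (f : Fin n → ℕ) → 1 ≤ ΣV f → ∃ λ v → 1 ≤ f v
ΣV-positive {suc n} f pos with f F.zero in eq
... | suc _ = F.zero , subst (1 ≤_) (sym eq) (s≤s z≤n)
... | zero  = let v , 1≤f = ΣV-positive (f ∘ F.suc) pos in F.suc v , 1≤f

ΣV-≤1 : ∀ {n} (f : Fin n → ℕ) → ΣV f ≤ 1 →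
        (∀ v → f v ≡ 0) ⊎ ∃ λ z → f z ≡ 1 × (∀ v → v ≢ z → f v ≡ 0)
ΣV-≤1 f Σ≤1 with n≤1⇒n≡0∨n≡1 Σ≤1
... | inj₁ Σ≡0 = inj₁ λ v → n≤0⇒n≡0 (subst (f v ≤_) Σ≡0 (term≤ΣV f v))
... | inj₂ Σ≡1 with ΣV-positive f (≤-reflexive (sym Σ≡1))
... | z , 1≤fz = inj₂ (z , ≤-antisym (≤-trans (term≤ΣV f z) Σ≤1) 1≤fz , off)
  where
  off : ∀ v → v ≢ z → f v ≡ 0
  off v v≢z = n≤0⇒n≡0 (+-cancelʳ-≤ 1 (f v) 0
    (≤-trans (+-monoʳ-≤ (f v) 1≤fz) (≤-trans (terms≤ΣV f v≢z) Σ≤1)))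

sumN-cong : ∀ l {f g : ℕ → ℕ} → (∀ d → f d ≡ g d) → sumN l f ≡ sumN l g
sumN-cong zero    f≡g = refl
sumN-cong (suc l) f≡g = cong₂ _+_ (sumN-cong l f≡g) (f≡g l)

sumN-zero : ∀ l {f : ℕ → ℕ} → (∀ d → d < l → f d ≡ 0) → sumN l f ≡ 0
sumN-zero zero    f≡0 = refl
sumN-zero (suc l) f≡0 = cong₂ _+_ (sumN-zero l (λ d d<l → f≡0 d (m<n⇒m<1+n d<l))) (f≡0 l ≤-refl)

sumN-positive : ∀ l (f : ℕ → ℕ) → 1 ≤ sumN l f → ∃ λ d → d < l × 1 ≤ f d
sumN-positive (suc l) f pos with f l in eq
... | suc _ = l , ≤-refl , subst (1 ≤_) (sym eq) (s≤s z≤n)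
... | zero  = let d , d<l , 1≤f = sumN-positive l f (subst (1 ≤_) (+-identityʳ _) pos)
              in d , m<n⇒m<1+n d<l , 1≤f

sumN-≤1 : ∀ l (f : ℕ → ℕ) → (∀ d → d < l → f d ≤ 1) →
          (∀ d d' → d < d' → d' < l → 1 ≤ f d → 1 ≤ f d' → ⊥) → sumN l f ≤ 1
sumN-≤1 zero    f bound excl = z≤n
sumN-≤1 (suc l) f bound excl with f l in eq
... | zero  = subst (_≤ 1) (sym (+-identityʳ _))
                (sumN-≤1 l f (λ d d<l → bound d (m<n⇒m<1+n d<l))
                             (λ d d' d<d' d'<l → excl d d' d<d' (m<n⇒m<1+n d'<l)))
... | suc a = subst (_≤ 1) (trans eq (cong (_+ suc a) (sym earlier≡0))) (bound l ≤-refl)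
  where
  1≤fl : 1 ≤ f l
  1≤fl = subst (1 ≤_) (sym eq) (s≤s z≤n)
  earlier≡0 : sumN l f ≡ 0
  earlier≡0 = sumN-zero l λ d d<l → n<1⇒n≡0 (≰⇒> λ 1≤fd → excl d l d<l ≤-refl 1≤fd 1≤fl)

<∸⇒+≤ : ∀ a b d → d < suc b ∸ a → a + d ≤ b
<∸⇒+≤ zero    b       d d< = ≤-pred d<
<∸⇒+≤ (suc a) zero    d d< = ⊥-elim (n≮0 (subst (d <_) (0∸n≡0 a) d<))
<∸⇒+≤ (suc a) (suc b) d d< = s≤s (<∸⇒+≤ a b d d<)

sumRange-positive : ∀ a b (f : ℕ → ℕ) → 1 ≤ sumRange a b f → ∃ λ l → a ≤ l × l ≤ b × 1 ≤ f l
sumRange-positive a b f pos =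
  let d , d< , 1≤f = sumN-positive (suc b ∸ a) (λ d → f (a + d)) pos
  in a + d , m≤m+n a d , <∸⇒+≤ a b d d< , 1≤f

sumRange-≤1 : ∀ a b (f : ℕ → ℕ) → (∀ l → a ≤ l → l ≤ b → f l ≤ 1) →
              (∀ l l' → a ≤ l → l < l' → l' ≤ b → 1 ≤ f l → 1 ≤ f l' → ⊥) → sumRange a b f ≤ 1
sumRange-≤1 a b f bound excl = sumN-≤1 (suc b ∸ a) (λ d → f (a + d))
  (λ d d< → bound (a + d) (m≤m+n a d) (<∸⇒+≤ a b d d<))
  (λ d d' d<d' d'< → excl (a + d) (a + d') (m≤m+n a d) (+-monoʳ-< a d<d') (<∸⇒+≤ a b d' d'<))

1≤m+n⇒1≤m⊎1≤n : ∀ a {b} → 1 ≤ a + b → 1 ≤ a ⊎ 1 ≤ b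
1≤m+n⇒1≤m⊎1≤n zero    1≤b = inj₂ 1≤b
1≤m+n⇒1≤m⊎1≤n (suc a) _   = inj₁ (s≤s z≤n)

exclusive-+≤1 : ∀ {a b} → a ≤ 1 → b ≤ 1 → (1 ≤ a → 1 ≤ b → ⊥) → a + b ≤ 1
exclusive-+≤1 z≤n       b≤1       _    = b≤1
exclusive-+≤1 (s≤s z≤n) z≤n       _    = s≤s z≤n
exclusive-+≤1 (s≤s z≤n) (s≤s z≤n) excl = ⊥-elim (excl (s≤s z≤n) (s≤s z≤n))

≡ᵇ-refl : ∀ n → (n ≡ᵇ n) ≡ true
≡ᵇ-refl n = dec-true (n ≟ n) refl

≢⇒≡ᵇ-false : ∀ {m n} → m ≢ n → (m ≡ᵇ n) ≡ false
≢⇒≡ᵇ-false {m} {n} = dec-false (m ≟ n)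

≡ᵇ-true⇒≡ : ∀ {m n} → (m ≡ᵇ n) ≡ true → m ≡ n
≡ᵇ-true⇒≡ {m} {n} eq = ≡ᵇ⇒≡ m n (subst T (sym eq) tt)

[]*-≤ : ∀ b a → [ b ] * a ≤ a
[]*-≤ false a = z≤n
[]*-≤ true  a = ≤-reflexive (+-identityʳ a)

[]*-positive : ∀ b {a} → 1 ≤ [ b ] * a → b ≡ true × 1 ≤ a
[]*-positive true {a} pos = refl , subst (1 ≤_) (+-identityʳ a) pos

[]*-*-zero : ∀ b a {y} → y ≡ 0 → [ b ] * (a * y) ≡ 0
[]*-*-zero b a refl = trans (cong ([ b ] *_) (*-zeroʳ a)) (*-zeroʳ [ b ])

indicatorSum≡0 : ∀ c l → l < c → sumN l (λ d → [ c ≡ᵇ suc d ] * suc d) ≡ 0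
indicatorSum≡0 c zero    _   = refl
indicatorSum≡0 c (suc l) l<c with c ≡ᵇ suc l in eq
... | true  = ⊥-elim (<-irrefl (sym (≡ᵇ-true⇒≡ eq)) l<c)
... | false = trans (+-identityʳ _) (indicatorSum≡0 c l (<-trans (n<1+n l) l<c))

indicatorSum≤ : ∀ c l → sumN l (λ d → [ c ≡ᵇ suc d ] * suc d) ≤ c
indicatorSum≤ c zero    = z≤n
indicatorSum≤ c (suc l) with c ≡ᵇ suc l in eq
... | false = subst (_≤ c) (sym (+-identityʳ _)) (indicatorSum≤ c l)
... | true  = ≤-reflexive (begin
    sumN l (λ d → [ c ≡ᵇ suc d ] * suc d) + (suc l + 0)
      ≡⟨ cong₂ _+_ (indicatorSum≡0 c l (≤-reflexive (sym c≡1+l))) (+-identityʳ _) ⟩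
    suc l
      ≡⟨ sym c≡1+l ⟩
    c ∎)
  where
  open ≡-Reasoning
  c≡1+l : c ≡ suc l
  c≡1+l = ≡ᵇ-true⇒≡ eq

-- The coefficient of y v k in the inequality when v ∈ N^c⟨U⟩ and p = |U|;
-- for c ≤ p it is min c (p − 1).
coefficient : ℕ → ℕ → ℕ
coefficient p c = [ c ≡ᵇ p ] * (p ∸ 1) + sumRange 1 (p ∸ 1) (λ q → [ c ≡ᵇ q ] * q)

coefficient-bound : ∀ {p c} → 1 ≤ p → c ≤ p → coefficient p c ≤ c × coefficient p c < p
coefficient-bound {suc p} {c} _ c≤p with m≤n⇒m<n∨m≡n c≤p
... | inj₁ c<p = subst (_≤ c) (sym coefficient≡) (indicatorSum≤ c p) ,
                 subst (_< suc p) (sym coefficient≡) (≤-<-trans (indicatorSum≤ c p) c<p)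
  where
  coefficient≡ : coefficient (suc p) c ≡ sumN p (λ d → [ c ≡ᵇ suc d ] * suc d)
  coefficient≡ = cong (λ b → [ b ] * p + sumN p (λ d → [ c ≡ᵇ suc d ] * suc d))
                      (≢⇒≡ᵇ-false (<⇒≢ c<p))
... | inj₂ refl = subst (_≤ suc p) (sym coefficient≡) (n≤1+n p) ,
                  subst (_< suc p) (sym coefficient≡) ≤-refl
  where
  open ≡-Reasoning
  coefficient≡ : coefficient (suc p) (suc p) ≡ p
  coefficient≡ = begin
    [ suc p ≡ᵇ suc p ] * p + sumN p (λ d → [ suc p ≡ᵇ suc d ] * suc d)
      ≡⟨ cong₂ (λ b s → [ b ] * p + s) (≡ᵇ-refl (suc p)) (indicatorSum≡0 (suc p) p ≤-refl) ⟩
    p + 0 + 0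
      ≡⟨ trans (+-identityʳ _) (+-identityʳ p) ⟩
    p ∎

-- The terms of the inequality that belong to step k, with c v = |N⟨v⟩ ∩ U| and Y v = y v k.
countTerms : ∀ {n} → ℕ → (Fin n → ℕ) → (Fin n → ℕ) → ℕ
countTerms p c Y = ΣV (λ v → [ c v ≡ᵇ p ] * ((p ∸ 1) * Y v))
                 + sumRange 1 (p ∸ 1) (λ q → ΣV (λ v → [ c v ≡ᵇ q ] * (q * Y v)))

countTerms-zero : ∀ {n} p (c Y : Fin n → ℕ) → (∀ v → Y v ≡ 0) → countTerms p c Y ≡ 0
countTerms-zero p c Y Y≡0 =
  cong₂ _+_ (vanish (λ v → c v ≡ᵇ p) (p ∸ 1))
            (sumN-zero (p ∸ 1) λ d _ → vanish (λ v → c v ≡ᵇ suc d) (suc d))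
  where
  vanish : ∀ b a → ΣV (λ v → [ b v ] * (a * Y v)) ≡ 0
  vanish b a = ΣV-zero λ v → []*-*-zero (b v) a (Y≡0 v)

countTerms-unit : ∀ {n} p (c Y : Fin n → ℕ) z → Y z ≡ 1 → (∀ v → v ≢ z → Y v ≡ 0) →
                  countTerms p c Y ≡ coefficient p (c z)
countTerms-unit p c Y z Yz≡1 off =
  cong₂ _+_ (at-z (λ v → c v ≡ᵇ p) (p ∸ 1))
            (sumN-cong (p ∸ 1) λ d → at-z (λ v → c v ≡ᵇ suc d) (suc d))
  where
  at-z : ∀ b a → ΣV (λ v → [ b v ] * (a * Y v)) ≡ [ b z ] * a
  at-z b a = begin
    ΣV (λ v → [ b v ] * (a * Y v))
      ≡⟨ ΣV-concentrated z (λ v v≢z → []*-*-zero (b v) a (off v v≢z)) ⟩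
    [ b z ] * (a * Y z)
      ≡⟨ cong (λ y → [ b z ] * (a * y)) Yz≡1 ⟩
    [ b z ] * (a * 1)
      ≡⟨ cong ([ b z ] *_) (*-identityʳ a) ⟩
    [ b z ] * a ∎
    where open ≡-Reasoning

NB-sym : ∀ {n} (G : Graph n) C u v → NB G C u v ≡ NB G C v u
NB-sym G C u v with u FP.≟ v
... | yes refl = refl
... | no u≢v rewrite ≢⇒≡ᵇ-false {toℕ v} {toℕ u} (λ e → u≢v (sym (FP.toℕ-injective e)))
                   | ≢⇒≡ᵇ-false {toℕ u} {toℕ v} (u≢v ∘ FP.toℕ-injective)
                   | ∧-zeroʳ (C u) | ∧-zeroʳ (C v) = Graph.sym G u v

≤-stepwise : ∀ {ℓ} (R : ℕ → ℕ → Set ℓ) → (∀ {a} → R a a) → (∀ {a b c} → R a b → R b c → R a c) →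
             ∀ {lo hi} → (∀ r → lo ≤ r → r < hi → R r (suc r)) →
             ∀ {a b} → lo ≤ a → a ≤ b → b ≤ hi → R a b
≤-stepwise R R-refl R-trans step lo≤a a≤b b≤hi with m≤n⇒m<n∨m≡n a≤b
... | inj₂ refl = R-refl
≤-stepwise R R-refl R-trans step {b = suc b} lo≤a _ b<hi | inj₁ (s≤s a≤b) =
  R-trans (≤-stepwise R R-refl R-trans step lo≤a a≤b (<⇒≤ b<hi)) (step b (≤-trans lo≤a a≤b) b<hi)

module FeasibleSolution {n} {G : Graph n} {C : Fin n → Bool} {m} {x y : Fin n → ℕ → ℕ}
                        (feasible : Feasible G C m x y) where
  open Feasible feasible

  Chosen : Fin n → ℕ → Set
  Chosen v l = 1 ≤ l × l ≤ m × 1 ≤ y v l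

  x-antitone : ∀ u {l l'} → 1 ≤ l → l ≤ l' → l' ≤ m → x u l' ≤ x u l
  x-antitone u = ≤-stepwise (λ a b → x u b ≤ x u a) ≤-refl (λ p q → ≤-trans q p)
                            (λ r 1≤r r<m → cc u (suc r) (s≤s 1≤r) r<m)

  chosen⇒x≡0 : ∀ {v l u l'} → Chosen v l → NB G C v u ≡ true → l ≤ l' → l' ≤ m → x u l' ≡ 0
  chosen⇒x≡0 {v} {l} {u} (1≤l , l≤m , 1≤y) vu l≤l' l'≤m =
    n≤0⇒n≡0 (≤-trans (x-antitone u 1≤l l≤l' l'≤m) x≤0)
    where
    y≤Σ : y v l ≤ ΣV (λ v' → [ NB G C u v' ] * y v' l)
    y≤Σ = ≤-trans (m≤m+n (y v l) 0)
            (subst (λ b → [ b ] * y v l ≤ ΣV (λ v' → [ NB G C u v' ] * y v' l))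
                   (trans (NB-sym G C u v) vu)
                   (term≤ΣV (λ v' → [ NB G C u v' ] * y v' l) v))
    x≤0 : x u l ≤ 0
    x≤0 = +-cancelʳ-≤ 1 (x u l) 0 (≤-trans (+-monoʳ-≤ (x u l) (≤-trans 1≤y y≤Σ)) (cd u l 1≤l l≤m))

  -- By (e), choosing v' at step l' needs a vertex of N⟨v'⟩ still undominated at step l' − 1,
  -- but N⟨v⟩ ⊇ N⟨v'⟩ is dominated from step l on.
  later-chosen-⊄ : ∀ {v l v' l'} → Chosen v l → Chosen v' l' → l < l' → ¬ NSub G C v' v
  later-chosen-⊄ {v} {l} {v'} {suc l'} cv@(1≤l , _) (_ , l'<m , 1≤y') (s≤s l≤l') v'⊆v =
    n≮0 (≤-trans 1≤y' (≤-trans (m≤m+n _ _) e-at-l'))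
    where
    vanish : ∀ u → [ NB G C v' u ] * x u l' ≡ 0
    vanish u with NB G C v' u in v'u
    ... | false = refl
    ... | true  = trans (+-identityʳ _) (chosen⇒x≡0 cv (v'⊆v u v'u) l≤l' (<⇒≤ l'<m))
    e-at-l' : y v' (suc l') + ΣV (λ u → [ NB G C v' u ] * x u (suc l')) ≤ 0
    e-at-l' = ≤-trans (ce v' (suc l') (s≤s (≤-trans 1≤l l≤l')) l'<m) (≤-reflexive (ΣV-zero vanish))

  chosen-once : ∀ {v l l'} → Chosen v l → Chosen v l' → l ≡ l'
  chosen-once {l = l} {l'} cv cv' with <-cmp l l'
  ... | tri< l<l' _ _ = ⊥-elim (later-chosen-⊄ cv cv' l<l' λ _ h → h)
  ... | tri≈ _ l≡l' _ = l≡l'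
  ... | tri> _ _ l'<l = ⊥-elim (later-chosen-⊄ cv' cv l'<l λ _ h → h)

  chosen-unique : ∀ {v v' l} → Chosen v l → Chosen v' l → v ≡ v'
  chosen-unique {v} {v'} {l} (1≤l , l≤m , 1≤y) (_ , _ , 1≤y') with v FP.≟ v'
  ... | yes v≡v' = v≡v'
  ... | no v≢v'  = ⊥-elim (1+n≰n (≤-trans (+-mono-≤ 1≤y 1≤y')
                     (≤-trans (terms≤ΣV (λ u → y u l) v≢v') (ca l 1≤l l≤m))))

  chosen-⊆⇒≡ : ∀ {v l v' l'} → Chosen v l → Chosen v' l' → l ≤ l' → NSub G C v' v → v ≡ v'
  chosen-⊆⇒≡ cv cv' l≤l' v'⊆v with m≤n⇒m<n∨m≡n l≤l'
  ... | inj₁ l<l' = ⊥-elim (later-chosen-⊄ cv cv' l<l' v'⊆v)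
  ... | inj₂ refl = chosen-unique cv cv'

  step-occupancy : ∀ {l} → 1 ≤ l → l ≤ m →
    (∀ v → y v l ≡ 0) ⊎ ∃ λ z → Chosen z l × y z l ≡ 1 × (∀ v → v ≢ z → y v l ≡ 0)
  step-occupancy {l} 1≤l l≤m with ΣV-≤1 (λ v → y v l) (ca l 1≤l l≤m)
  ... | inj₁ none = inj₁ none
  ... | inj₂ (z , yz≡1 , off) = inj₂ (z , (1≤l , l≤m , ≤-reflexive (sym yz≡1)) , yz≡1 , off)

  x-on-U≤card : ∀ U {i} → 1 ≤ i → i ≤ m → ΣV (λ u → [ U u ] * x u i) ≤ card U
  x-on-U≤card U {i} 1≤i i≤m = ΣV-mono-≤ pointwise
    where
    pointwise : ∀ u → [ U u ] * x u i ≤ [ U u ]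
    pointwise u with U u
    ... | false = z≤n
    ... | true  = subst (_≤ 1) (sym (+-identityʳ _)) (xbin u i 1≤i i≤m)

  x-on-U+cnt≤card : ∀ U {v l i} → Chosen v l → l ≤ i → i ≤ m →
                    ΣV (λ u → [ U u ] * x u i) + cnt G C U v ≤ card U
  x-on-U+cnt≤card U {v} {l} {i} cv l≤i i≤m =
    subst (_≤ card U) (sym (ΣV-+ (λ u → [ U u ] * x u i) (λ u → [ NB G C v u ∧ U u ])))
          (ΣV-mono-≤ pointwise)
    where
    pointwise : ∀ u → [ U u ] * x u i + [ NB G C v u ∧ U u ] ≤ [ U u ]
    pointwise u with U u | NB G C v u in vu
    ... | false | false = z≤n
    ... | false | true  = z≤n
    ... | true  | false = subst (_≤ 1) (sym (trans (+-identityʳ _) (+-identityʳ _)))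
                            (xbin u i (≤-trans (proj₁ cv) l≤i) i≤m)
    ... | true  | true  rewrite chosen⇒x≡0 cv vu l≤i i≤m = ≤-refl

  fully-chosen⇒x-on-U≡0 : ∀ U {v l i} → Chosen v l → l ≤ i → i ≤ m → cnt G C U v ≡ card U →
                          ΣV (λ u → [ U u ] * x u i) ≡ 0
  fully-chosen⇒x-on-U≡0 U {i = i} cv l≤i i≤m full = n≤0⇒n≡0 (+-cancelʳ-≤ (card U) _ 0
    (subst (λ c → ΣV (λ u → [ U u ] * x u i) + c ≤ card U) full (x-on-U+cnt≤card U cv l≤i i≤m)))

  countTerms-bound : ∀ U {i k} → 1 ≤ k → k ≤ i → i ≤ m → 1 ≤ card U →
    ΣV (λ u → [ U u ] * x u i) + countTerms (card U) (cnt G C U) (λ v → y v k) ≤ card U ×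
    countTerms (card U) (cnt G C U) (λ v → y v k) < card U
  countTerms-bound U {i} {k} 1≤k k≤i i≤m 1≤p with step-occupancy 1≤k (≤-trans k≤i i≤m)
  ... | inj₁ none rewrite countTerms-zero (card U) (cnt G C U) (λ v → y v k) none =
    subst (_≤ card U) (sym (+-identityʳ _)) (x-on-U≤card U (≤-trans 1≤k k≤i) i≤m) , 1≤p
  ... | inj₂ (z , cz , yz≡1 , off)
    rewrite countTerms-unit (card U) (cnt G C U) (λ v → y v k) z yz≡1 off =
    ≤-trans (+-monoʳ-≤ _ (proj₁ coefficient≤)) A+c≤p , proj₂ coefficient≤
    where
    A+c≤p : ΣV (λ u → [ U u ] * x u i) + cnt G C U z ≤ card U
    A+c≤p = x-on-U+cnt≤card U cz k≤i i≤m
    coefficient≤ : coefficient (card U) (cnt G C U z) ≤ cnt G C U z ×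
                   coefficient (card U) (cnt G C U z) < card U
    coefficient≤ = coefficient-bound 1≤p (m+n≤o⇒n≤o _ A+c≤p)

  module Chain (U Nset : Fin n → Bool) {i} (1≤i : 1 ≤ i) (i≤m : i ≤ m)
    (N-full : ∀ v → Nset v ≡ true → cnt G C U v ≡ card U)
    {t} (w : ℕ → Fin n)
    (w-injective : ∀ r s → 1 ≤ r → r ≤ t → 1 ≤ s → s ≤ t → w r ≡ w s → r ≡ s)
    (w-full-∉N : ∀ r → 1 ≤ r → r ≤ t → (cnt G C U (w r) ≡ card U) × (Nset (w r) ≡ false))
    (w-decreasing : ∀ r → 1 ≤ r → r < t → NSub G C (w (r + 1)) (w r))
    (N⊆w-last : ∀ v → Nset v ≡ true → NSub G C v (w t))
    (j : ℕ → ℕ) (j-range : ∀ r → 1 ≤ r → r ≤ t + 1 → (1 ≤ j r) × (j r ≤ i))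
    (j-step : ∀ r → 1 ≤ r → r ≤ t → j r ≤ j (r + 1)) where

    Nterms : ℕ
    Nterms = ΣV (λ v → [ Nset v ] * y v i)

    segment : ℕ → ℕ
    segment r = sumRange (j r) (j (r + 1)) (y (w r))

    wterms : ℕ
    wterms = sumRange 1 t segment

    w-⊆ : ∀ {r s} → 1 ≤ r → r ≤ s → s ≤ t → NSub G C (w s) (w r)
    w-⊆ = ≤-stepwise (λ a b → NSub G C (w b) (w a)) (λ _ h → h) (λ p q u h → p u (q u h))
            (λ r 1≤r r<t → subst (λ s → NSub G C (w s) (w r)) (+-comm r 1) (w-decreasing r 1≤r r<t))

    j-mono : ∀ {a b} → 1 ≤ a → a ≤ b → b ≤ t + 1 → j a ≤ j b
    j-mono {b = b} 1≤a a≤b b≤t+1 =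
      ≤-stepwise (λ a b → j a ≤ j b) ≤-refl ≤-trans
        (λ r 1≤r r<1+t → subst (λ s → j r ≤ j s) (+-comm r 1) (j-step r 1≤r (≤-pred r<1+t)))
        1≤a a≤b (subst (b ≤_) (+-comm t 1) b≤t+1)

    segment-steps : ∀ {r l} → 1 ≤ r → r ≤ t → j r ≤ l → l ≤ j (r + 1) → 1 ≤ l × l ≤ i
    segment-steps {r} 1≤r r≤t jr≤l l≤jr' =
      ≤-trans (proj₁ (j-range r 1≤r (m≤n⇒m≤n+o 1 r≤t))) jr≤l ,
      ≤-trans l≤jr' (proj₂ (j-range (r + 1) (≤-trans 1≤r (m≤m+n r 1)) (+-monoˡ-≤ 1 r≤t)))

    segment-chosen-at : ∀ {r l} → 1 ≤ r → r ≤ t → j r ≤ l → l ≤ j (r + 1) → 1 ≤ y (w r) l →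
                        Chosen (w r) l
    segment-chosen-at 1≤r r≤t jr≤l l≤jr' 1≤y =
      let 1≤l , l≤i = segment-steps 1≤r r≤t jr≤l l≤jr' in 1≤l , ≤-trans l≤i i≤m , 1≤y

    segment-chosen : ∀ {r} → 1 ≤ r → r ≤ t → 1 ≤ segment r →
                     ∃ λ l → Chosen (w r) l × j r ≤ l × l ≤ j (r + 1)
    segment-chosen {r} 1≤r r≤t pos =
      let l , jr≤l , l≤jr' , 1≤y = sumRange-positive (j r) (j (r + 1)) (y (w r)) pos
      in l , segment-chosen-at 1≤r r≤t jr≤l l≤jr' 1≤y , jr≤l , l≤jr'

    segment-≤1 : ∀ {r} → 1 ≤ r → r ≤ t → segment r ≤ 1
    segment-≤1 {r} 1≤r r≤t = sumRange-≤1 (j r) (j (r + 1)) (y (w r)) bound excl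
      where
      bound : ∀ l → j r ≤ l → l ≤ j (r + 1) → y (w r) l ≤ 1
      bound l jr≤l l≤jr' = let 1≤l , l≤i = segment-steps 1≤r r≤t jr≤l l≤jr'
                           in ybin (w r) l 1≤l (≤-trans l≤i i≤m)
      excl : ∀ l l' → j r ≤ l → l < l' → l' ≤ j (r + 1) → 1 ≤ y (w r) l → 1 ≤ y (w r) l' → ⊥
      excl l l' jr≤l l<l' l'≤jr' 1≤y 1≤y' = <⇒≢ l<l' (chosen-once
        (segment-chosen-at 1≤r r≤t jr≤l (≤-trans (<⇒≤ l<l') l'≤jr') 1≤y)
        (segment-chosen-at 1≤r r≤t (≤-trans jr≤l (<⇒≤ l<l')) l'≤jr' 1≤y'))

    wterms-≤1 : wterms ≤ 1
    wterms-≤1 = sumRange-≤1 1 t segment (λ r 1≤r r≤t → segment-≤1 1≤r r≤t) excl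
      where
      excl : ∀ r r' → 1 ≤ r → r < r' → r' ≤ t → 1 ≤ segment r → 1 ≤ segment r' → ⊥
      excl r r' 1≤r r<r' r'≤t pos pos' =
        let 1≤r' = ≤-trans 1≤r (<⇒≤ r<r')
            r≤t  = ≤-trans (<⇒≤ r<r') r'≤t
            l  , cl  , _     , l≤j = segment-chosen 1≤r r≤t pos
            l' , cl' , j≤l'  , _   = segment-chosen 1≤r' r'≤t pos'
            r+1≤r' = subst (_≤ r') (+-comm 1 r) r<r'
            j≤j = j-mono (≤-trans 1≤r (m≤m+n r 1)) r+1≤r' (m≤n⇒m≤n+o 1 r'≤t)
            wr≡wr' = chosen-⊆⇒≡ cl cl' (≤-trans l≤j (≤-trans j≤j j≤l')) (w-⊆ 1≤r (<⇒≤ r<r') r'≤t)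
        in <⇒≢ r<r' (w-injective r r' 1≤r r≤t 1≤r' r'≤t wr≡wr')

    Nterms-≤1 : Nterms ≤ 1
    Nterms-≤1 = ≤-trans (ΣV-mono-≤ λ v → []*-≤ (Nset v) (y v i)) (ca i 1≤i i≤m)

    N-chosen : 1 ≤ Nterms → ∃ λ v → Nset v ≡ true × Chosen v i
    N-chosen pos =
      let v , 1≤term = ΣV-positive (λ v → [ Nset v ] * y v i) pos
          v∈N , 1≤y = []*-positive (Nset v) 1≤term
      in v , v∈N , 1≤i , i≤m , 1≤y

    Nterms-wterms-exclusive : 1 ≤ Nterms → 1 ≤ wterms → ⊥
    Nterms-wterms-exclusive posN posw =
      let v , v∈N , cv = N-chosen posN
          r , 1≤r , r≤t , pos = sumRange-positive 1 t segment posw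
          l , cl , jr≤l , l≤jr' = segment-chosen 1≤r r≤t pos
          v⊆wr : NSub G C v (w r)
          v⊆wr u h = w-⊆ 1≤r r≤t ≤-refl u (N⊆w-last v v∈N u h)
          wr≡v = chosen-⊆⇒≡ cl cv (proj₂ (segment-steps 1≤r r≤t jr≤l l≤jr')) v⊆wr
      in false≢true (trans (sym (proj₂ (w-full-∉N r 1≤r r≤t)))
                           (subst (λ z → Nset z ≡ true) (sym wr≡v) v∈N))
      where
      false≢true : false ≢ true
      false≢true ()

    chain-≤1 : Nterms + wterms ≤ 1
    chain-≤1 = exclusive-+≤1 Nterms-≤1 wterms-≤1 Nterms-wterms-exclusive

    chain-active⇒x-on-U≡0 : 1 ≤ Nterms + wterms → ΣV (λ u → [ U u ] * x u i) ≡ 0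
    chain-active⇒x-on-U≡0 active with 1≤m+n⇒1≤m⊎1≤n Nterms active
    ... | inj₁ posN = let v , v∈N , cv = N-chosen posN
                      in fully-chosen⇒x-on-U≡0 U cv ≤-refl i≤m (N-full v v∈N)
    ... | inj₂ posw = let r , 1≤r , r≤t , pos = sumRange-positive 1 t segment posw
                          l , cl , jr≤l , l≤jr' = segment-chosen 1≤r r≤t pos
                      in fully-chosen⇒x-on-U≡0 U cl (proj₂ (segment-steps 1≤r r≤t jr≤l l≤jr')) i≤m
                                               (proj₁ (w-full-∉N r 1≤r r≤t))

member⇒1≤card : ∀ {n} (U : Fin n → Bool) {u} → U u ≡ true → 1 ≤ card U
member⇒1≤card U {u} u∈U =
  ≤-trans (subst (λ b → 1 ≤ [ b ]) (sym u∈U) ≤-refl) (term≤ΣV (λ v → [ U v ]) u)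

bound-split : ∀ {a b c d e p} → b + c ≤ 1 → (1 ≤ b + c → a ≡ 0) → a + (d + e) ≤ p → d + e < p →
              a + b + c + d + e ≤ p
bound-split {a} {b} {c} {d} {e} {p} b+c≤1 active⇒a≡0 a+D≤p D<p =
  subst (_≤ p) (sym reassoc) (by-cases (b + c) b+c≤1 active⇒a≡0)
  where
  open ≡-Reasoning
  reassoc : a + b + c + d + e ≡ a + (b + c) + (d + e)
  reassoc = begin
    a + b + c + d + e     ≡⟨ +-assoc (a + b + c) d e ⟩
    a + b + c + (d + e)   ≡⟨ cong (_+ (d + e)) (+-assoc a b c) ⟩
    a + (b + c) + (d + e) ∎
  by-cases : ∀ s → s ≤ 1 → (1 ≤ s → a ≡ 0) → a + s + (d + e) ≤ p
  by-cases zero          _        _ = subst (λ z → z + (d + e) ≤ p) (sym (+-identityʳ a)) a+D≤p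
  by-cases (suc zero)    _        s≥1⇒a≡0 rewrite s≥1⇒a≡0 (s≤s z≤n) = D<p
  by-cases (suc (suc _)) (s≤s ()) _

-- The Grundy bound, the isolated-vertex condition, m ≥ 2, t ≥ 1 and the end values of j are
-- not needed: the inequality holds at every feasible point of F₁.
theorem2 : {n : ℕ} (G : Graph n) (C : Fin n → Bool)
    → (∀ v → C v ≡ false → ∃ λ u → adj G v u ≡ true)
    → (m : ℕ) → 2 ≤ m → GrundyAtMost G C m
    → (i : ℕ) → 2 ≤ i → i ≤ m
    → (k : ℕ) → 1 ≤ k → k ≤ i
    → (U : Fin n → Bool) → (∃ λ u → U u ≡ true)
    → (Nset : Fin n → Bool) → (∀ v → Nset v ≡ true → cnt G C U v ≡ card U)
    → (t : ℕ) → 1 ≤ t → (w : ℕ → Fin n)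
    → (∀ r s → 1 ≤ r → r ≤ t → 1 ≤ s → s ≤ t → w r ≡ w s → r ≡ s)
    → (∀ r → 1 ≤ r → r ≤ t → (cnt G C U (w r) ≡ card U) × (Nset (w r) ≡ false))
    → (∀ r → 1 ≤ r → r < t → NSub G C (w (r + 1)) (w r))
    → (∀ v → Nset v ≡ true → NSub G C v (w t))
    → (j : ℕ → ℕ)
    → (∀ r → 1 ≤ r → r ≤ t + 1 → (1 ≤ j r) × (j r ≤ i))
    → j 1 ≡ 1 → j (t + 1) ≡ i
    → (∀ r → 1 ≤ r → r ≤ t → j r ≤ j (r + 1))
    → (x y : Fin n → ℕ → ℕ) → Feasible G C m x y
    → ΣV (λ u → [ U u ] * x u i)
      + ΣV (λ v → [ Nset v ] * y v i)
      + sumRange 1 t (λ r → sumRange (j r) (j (r + 1)) (λ l → y (w r) l))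
      + ΣV (λ v → [ cnt G C U v ≡ᵇ card U ] * ((card U ∸ 1) * y v k))
      + sumRange 1 (card U ∸ 1)
          (λ q → ΣV (λ v → [ cnt G C U v ≡ᵇ q ] * (q * y v k)))
      ≤ card U
theorem2 G C _ m _ _ i 2≤i i≤m k 1≤k k≤i U (_ , u∈U) Nset N-full t _ w w-injective w-full-∉N
         w-decreasing N⊆w-last j j-range _ _ j-step x y feasible =
  bound-split chain-≤1 chain-active⇒x-on-U≡0 (proj₁ step-k) (proj₂ step-k)
  where
  open FeasibleSolution feasible
  open Chain U Nset (≤-trans (s≤s z≤n) 2≤i) i≤m N-full w w-injective w-full-∉N w-decreasing
             N⊆w-last j j-range j-step
  step-k : ΣV (λ u → [ U u ] * x u i) + countTerms (card U) (cnt G C U) (λ v → y v k) ≤ card U ×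
           countTerms (card U) (cnt G C U) (λ v → y v k) < card U
  step-k = countTerms-bound U 1≤k k≤i i≤m (member⇒1≤card U u∈U)
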